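{- Suppose that $\mathbb F$ is a field of characteristic $p\neq 2$ and let $0\le k\le n$. Then the elements $[a,b]$ with $a,b\subseteq\dot V$, $a\cap b=\emptyset$ and $|a|+|b|=k$ form a basis of $M^n_k$.
   Context: Let $V=\{\alpha_1,\bar\alpha_1,\dots,\alpha_n,\bar\alpha_n\}$ be a set of $2n$ distinct elements, with $\bar{\bar\alpha}_i=\alpha_i$. For $0\le k\le n$, $L^n_k$ is the set of $k$-element subsets $x\subseteq V$ with $|x\cap\{\alpha_i,\bar\alpha_i\}|\le1$ for all $i$, and $M^n_k$ is the $\mathbb F$-vector space with basis $L^n_k$. Elements are written as polynomials in the vertices: a product of distinct vertices forming such a set denotes that set, extended bilinearly. Let $\dot V=\{\alpha_1,\dots,\alpha_n\}$; for disjoint $a,b\subseteq\dot V$, $[a,b]=\prod_{\alpha\in a}(\alpha+\bar\alpha)\prod_{\beta\in b}(\beta-\bar\beta)\in M^n_{|a|+|b|}$, with $[\emptyset,\emptyset]=\emptyset$ (the empty face). -}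

module Defs where

open import Level using (Level; _⊔_)
open import Data.Nat using (ℕ; zero; suc)
open import Data.Product using (Σ; ∃; _×_; _,_)
open import Relation.Nullary using (¬_)
open import Algebra.Bundles using (CommutativeRing)

record IsField {c ℓ : Level} (R : CommutativeRing c ℓ) : Set (c ⊔ ℓ) where
  open CommutativeRing R
  field
    1≉0     : ¬ (1# ≈ 0#)
    inverse : ∀ x → ¬ (x ≈ 0#) → Σ Carrier λ y → x * y ≈ 1#

-- Characteristic ≠ 2 (this includes characteristic 0): 2 = 1 + 1 ≠ 0.
CharNot2 : {c ℓ : Level} → CommutativeRing c ℓ → Set ℓ
CharNot2 R = ¬ (1# + 1# ≈ 0#) where open CommutativeRing R

-- A face is described coordinate-wise over
-- i = 1..n : either it contains neither α_i nor ᾱ_i (skip), or contains α_i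
-- (pos), or contains ᾱ_i (neg); the index k counts the chosen vertices.
data Face : ℕ → ℕ → Set where
  []   : Face zero zero
  skip : ∀ {n k} → Face n k → Face (suc n) k
  pos  : ∀ {n k} → Face n k → Face (suc n) (suc k)
  neg  : ∀ {n k} → Face n k → Face (suc n) (suc k)

-- The same type also indexes the pairs (a , b) of disjoint subsets of
-- V̇ = {α_1..α_n} with |a| + |b| = k : coordinate i is 'pos' iff α_i ∈ a,
-- 'neg' iff α_i ∈ b, 'skip' otherwise.
DisjointPair : ℕ → ℕ → Set
DisjointPair = Face

module Space {c ℓ : Level} (R : CommutativeRing c ℓ) where
  open CommutativeRing R hiding (zero)

  -- M^n_k : the free F-module on L^n_k, i.e. coefficient functions.
  M : ℕ → ℕ → Set c
  M n k = Face n k → Carrier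

  zeroV : ∀ {n k} → M n k
  zeroV _ = 0#

  _+V_ : ∀ {n k} → M n k → M n k → M n k
  (u +V v) x = u x + v x

  _-V_ : ∀ {n k} → M n k → M n k → M n k
  (u -V v) x = u x - v x

  _≈V_ : ∀ {n k} → M n k → M n k → Set ℓ
  u ≈V v = ∀ x → u x ≈ v x

  -- Multiplying a vector v ∈ M^n_k (in the vertices of coordinates 2..n+1)
  -- by the vertex α_1, resp. ᾱ_1, of the new first coordinate, and the
  -- inclusion M^n_k → M^(n+1)_k (the same polynomial, not using coordinate 1).
  mulα : ∀ {n k} → M n k → M (suc n) (suc k)
  mulα v (pos x) = v x
  mulα v (neg x) = 0#
  mulα v (skip x) = 0#

  mulᾱ : ∀ {n k} → M n k → M (suc n) (suc k)
  mulᾱ v (pos x) = 0#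
  mulᾱ v (neg x) = v x
  mulᾱ v (skip x) = 0#

  incl : ∀ {n k} → M n k → M (suc n) k
  incl v (skip x) = v x
  incl v (pos x) = 0#
  incl v (neg x) = 0#

  emptyFace : M zero zero
  emptyFace [] = 1#

  -- [a , b] = ∏_{α∈a} (α + ᾱ) ∏_{β∈b} (β - β̄), built up one coordinate
  -- at a time; [∅ , ∅] = ∅.
  bracket : ∀ {n k} → DisjointPair n k → M n k
  bracket [] = emptyFace
  bracket (skip ab) = incl (bracket ab)
  bracket (pos ab) = mulα (bracket ab) +V mulᾱ (bracket ab)
  bracket (neg ab) = mulα (bracket ab) -V mulᾱ (bracket ab)

  sumF : ∀ {n k} → (Face n k → Carrier) → Carrier
  sumF {zero} {zero} f = f []
  sumF {zero} {suc k} f = 0#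
  sumF {suc n} {zero} f = sumF (λ x → f (skip x))
  sumF {suc n} {suc k} f =
    sumF (λ x → f (skip x)) + (sumF (λ x → f (pos x)) + sumF (λ x → f (neg x)))

  combo : ∀ {n k} → (DisjointPair n k → Carrier) → M n k
  combo coeffs x = sumF (λ ab → coeffs ab * bracket ab x)

  IsBasisOfBrackets : ℕ → ℕ → Set (c ⊔ ℓ)
  IsBasisOfBrackets n k =
    (∀ (coeffs : DisjointPair n k → Carrier) → combo coeffs ≈V zeroV →
       ∀ ab → coeffs ab ≈ 0#)
    × (∀ (v : M n k) → ∃ λ (coeffs : DisjointPair n k → Carrier) → combo coeffs ≈V v)

module Submission where

-- Split off the first coordinate.  A combination ∑ c(a,b)[a,b], evaluated on a
-- face avoiding α₁ and ᾱ₁, only sees the pairs with α₁ ∉ a ∪ b; on the faces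
-- α₁x and ᾱ₁x it equals P(x) + N(x) and P(x) − N(x), where P and N are the
-- combinations of the pairs with α₁ ∈ a, resp. α₁ ∈ b, with α₁ removed.  Thus
-- the coefficient map is block triangular with recursive diagonal blocks and
-- the block (1 1; 1 −1), which is invertible exactly when 2 is; induct on n.

open import Defs
open import Level using (Level)
open import Data.Nat using (ℕ; _≤_; zero; suc)
open import Data.Product using (Σ; ∃; _×_; _,_; proj₁; proj₂)
open import Algebra.Bundles using (CommutativeRing)

module BracketBasis {c ℓ : Level} (R : CommutativeRing c ℓ) where
  open CommutativeRing R hiding (zero)
  open Space R
  open import Algebra.Properties.Ring ring using (-0#≈0#; -‿distribʳ-*; -‿+-comm; x[y-z]≈xy-xz)
  open import Algebra.Properties.AbelianGroup +-abelianGroup using (⁻¹-anti-homo‿-)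
  open import Algebra.Properties.CommutativeSemigroup +-commutativeSemigroup
    using (interchange)
  open import Relation.Binary.Reasoning.Setoid setoid

  x-0≈x : ∀ x → x - 0# ≈ x
  x-0≈x x = trans (+-congˡ -0#≈0#) (+-identityʳ x)

  [x+y]+[x-y]≈x+x : ∀ x y → (x + y) + (x - y) ≈ x + x
  [x+y]+[x-y]≈x+x x y = begin
    (x + y) + (x - y)   ≈⟨ interchange x y x (- y) ⟩
    (x + x) + (y - y)   ≈⟨ +-congˡ (-‿inverseʳ y) ⟩
    (x + x) + 0#        ≈⟨ +-identityʳ _ ⟩
    x + x               ∎

  [x+y]-[x-y]≈y+y : ∀ x y → (x + y) - (x - y) ≈ y + y
  [x+y]-[x-y]≈y+y x y = begin
    (x + y) - (x - y)   ≈⟨ +-congˡ (⁻¹-anti-homo‿- x y) ⟩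
    (x + y) + (y - x)   ≈⟨ +-congˡ (+-comm y (- x)) ⟩
    (x + y) + (- x + y) ≈⟨ interchange x y (- x) y ⟩
    (x - x) + (y + y)   ≈⟨ +-congʳ (-‿inverseʳ x) ⟩
    0# + (y + y)        ≈⟨ +-identityˡ _ ⟩
    y + y               ∎

  sumF-cong : ∀ {n k} {f g : Face n k → Carrier} → (∀ x → f x ≈ g x) → sumF f ≈ sumF g
  sumF-cong {zero}  {zero}  f≈g = f≈g []
  sumF-cong {zero}  {suc k} f≈g = refl
  sumF-cong {suc n} {zero}  f≈g = sumF-cong (λ x → f≈g (skip x))
  sumF-cong {suc n} {suc k} f≈g = +-cong (sumF-cong (λ x → f≈g (skip x)))
    (+-cong (sumF-cong (λ x → f≈g (pos x))) (sumF-cong (λ x → f≈g (neg x))))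

  sumF-zero : ∀ {n k} {f : Face n k → Carrier} → (∀ x → f x ≈ 0#) → sumF f ≈ 0#
  sumF-zero {zero}  {zero}  f≈0 = f≈0 []
  sumF-zero {zero}  {suc k} f≈0 = refl
  sumF-zero {suc n} {zero}  f≈0 = sumF-zero (λ x → f≈0 (skip x))
  sumF-zero {suc n} {suc k} f≈0 =
    trans (+-cong (sumF-zero (λ x → f≈0 (skip x)))
                  (+-cong (sumF-zero (λ x → f≈0 (pos x))) (sumF-zero (λ x → f≈0 (neg x)))))
          (trans (+-identityˡ _) (+-identityˡ _))

  sumF-neg : ∀ {n k} (f : Face n k → Carrier) → sumF (λ x → - f x) ≈ - sumF f
  sumF-neg {zero}  {zero}  f = refl
  sumF-neg {zero}  {suc k} f = sym -0#≈0#
  sumF-neg {suc n} {zero}  f = sumF-neg (λ x → f (skip x))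
  sumF-neg {suc n} {suc k} f =
    trans (+-cong (sumF-neg (λ x → f (skip x)))
                  (+-cong (sumF-neg (λ x → f (pos x))) (sumF-neg (λ x → f (neg x)))))
          (trans (+-congˡ (-‿+-comm _ _)) (-‿+-comm _ _))

  module _ {n k : ℕ} (cs : DisjointPair (suc n) (suc k) → Carrier) where

    combo-skip : ∀ x → combo cs (skip x) ≈ combo (λ ab → cs (skip ab)) x
    combo-skip x = trans (+-congˡ (trans (+-cong (sumF-zero pos-part) (sumF-zero neg-part))
                                         (+-identityˡ 0#)))
                         (+-identityʳ _)
      where
      pos-part : ∀ (ab : DisjointPair n k) → cs (pos ab) * (0# + 0#) ≈ 0#
      pos-part _ = trans (*-congˡ (+-identityˡ 0#)) (zeroʳ _)
      neg-part : ∀ (ab : DisjointPair n k) → cs (neg ab) * (0# - 0#) ≈ 0#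
      neg-part _ = trans (*-congˡ (x-0≈x 0#)) (zeroʳ _)

    private
      skip-part≈0 : ∀ (x : Face n k) → sumF (λ ab → cs (skip ab) * bracket (skip ab) (pos x)) ≈ 0#
      skip-part≈0 x = sumF-zero {n} {suc k} (λ _ → zeroʳ _)

    combo-pos : ∀ x → combo cs (pos x) ≈ combo (λ ab → cs (pos ab)) x + combo (λ ab → cs (neg ab)) x
    combo-pos x = trans (+-cong (skip-part≈0 x)
                                (+-cong (sumF-cong {n} {k} (λ _ → *-congˡ (+-identityʳ _)))
                                        (sumF-cong {n} {k} (λ _ → *-congˡ (x-0≈x _)))))
                        (+-identityˡ _)

    combo-neg : ∀ x → combo cs (neg x) ≈ combo (λ ab → cs (pos ab)) x - combo (λ ab → cs (neg ab)) x
    combo-neg x = trans (+-cong (skip-part≈0 x)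
                                (+-cong (sumF-cong {n} {k} (λ _ → *-congˡ (+-identityˡ _)))
                                        (trans (sumF-cong negate) (sumF-neg {n} {k} _))))
                        (+-identityˡ _)
      where
      negate : ∀ ab → cs (neg ab) * (0# - bracket ab x) ≈ - (cs (neg ab) * bracket ab x)
      negate ab = trans (*-congˡ (+-identityˡ _)) (sym (-‿distribʳ-* _ _))

  module _ (½ : Carrier) (½+½≈1 : ½ + ½ ≈ 1#) where

    ½[x+x]≈x : ∀ x → ½ * (x + x) ≈ x
    ½[x+x]≈x x = begin
      ½ * (x + x)     ≈⟨ distribˡ ½ x x ⟩
      ½ * x + ½ * x   ≈⟨ distribʳ x ½ ½ ⟨
      (½ + ½) * x     ≈⟨ *-congʳ ½+½≈1 ⟩
      1# * x          ≈⟨ *-identityˡ x ⟩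
      x               ∎

    x+y≈0∧x-y≈0⇒x≈0×y≈0 : ∀ {x y} → x + y ≈ 0# → x - y ≈ 0# → x ≈ 0# × y ≈ 0#
    x+y≈0∧x-y≈0⇒x≈0×y≈0 {x} {y} x+y≈0 x-y≈0 = x≈0 , y≈0
      where
      x≈0 : x ≈ 0#
      x≈0 = begin
        x                         ≈⟨ ½[x+x]≈x x ⟨
        ½ * (x + x)               ≈⟨ *-congˡ ([x+y]+[x-y]≈x+x x y) ⟨
        ½ * ((x + y) + (x - y))   ≈⟨ *-congˡ (+-cong x+y≈0 x-y≈0) ⟩
        ½ * (0# + 0#)             ≈⟨ *-congˡ (+-identityˡ 0#) ⟩
        ½ * 0#                    ≈⟨ zeroʳ ½ ⟩
        0#                        ∎
      y≈0 : y ≈ 0#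
      y≈0 = begin
        y         ≈⟨ +-identityˡ y ⟨
        0# + y    ≈⟨ +-congʳ x≈0 ⟨
        x + y     ≈⟨ x+y≈0 ⟩
        0#        ∎

    ½[x+y]+½[x-y]≈x : ∀ x y → ½ * (x + y) + ½ * (x - y) ≈ x
    ½[x+y]+½[x-y]≈x x y = begin
      ½ * (x + y) + ½ * (x - y)   ≈⟨ distribˡ ½ (x + y) (x - y) ⟨
      ½ * ((x + y) + (x - y))     ≈⟨ *-congˡ ([x+y]+[x-y]≈x+x x y) ⟩
      ½ * (x + x)                 ≈⟨ ½[x+x]≈x x ⟩
      x                           ∎

    ½[x+y]-½[x-y]≈y : ∀ x y → ½ * (x + y) - ½ * (x - y) ≈ y
    ½[x+y]-½[x-y]≈y x y = begin
      ½ * (x + y) - ½ * (x - y)   ≈⟨ x[y-z]≈xy-xz ½ (x + y) (x - y) ⟨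
      ½ * ((x + y) - (x - y))     ≈⟨ *-congˡ ([x+y]-[x-y]≈y+y x y) ⟩
      ½ * (y + y)                 ≈⟨ ½[x+x]≈x y ⟩
      y                           ∎

    combo≈0⇒pos-and-neg-parts≈0 : ∀ {n k} (cs : DisjointPair (suc n) (suc k) → Carrier) → combo cs ≈V zeroV →
      ∀ x → combo (λ ab → cs (pos ab)) x ≈ 0# × combo (λ ab → cs (neg ab)) x ≈ 0#
    combo≈0⇒pos-and-neg-parts≈0 cs combo≈0 x = x+y≈0∧x-y≈0⇒x≈0×y≈0
      (trans (sym (combo-pos cs x)) (combo≈0 (pos x)))
      (trans (sym (combo-neg cs x)) (combo≈0 (neg x)))

    brackets-independent : ∀ n k (cs : DisjointPair n k → Carrier) →
      combo cs ≈V zeroV → ∀ ab → cs ab ≈ 0#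
    brackets-independent zero    zero    cs combo≈0 [] = trans (sym (*-identityʳ _)) (combo≈0 [])
    brackets-independent (suc n) zero    cs combo≈0 (skip ab) =
      brackets-independent n zero (λ a → cs (skip a)) (λ x → combo≈0 (skip x)) ab
    brackets-independent (suc n) (suc k) cs combo≈0 (skip ab) =
      brackets-independent n (suc k) (λ a → cs (skip a))
        (λ x → trans (sym (combo-skip cs x)) (combo≈0 (skip x))) ab
    brackets-independent (suc n) (suc k) cs combo≈0 (pos ab) =
      brackets-independent n k (λ a → cs (pos a)) (λ x → proj₁ (combo≈0⇒pos-and-neg-parts≈0 cs combo≈0 x)) ab
    brackets-independent (suc n) (suc k) cs combo≈0 (neg ab) =
      brackets-independent n k (λ a → cs (neg a)) (λ x → proj₂ (combo≈0⇒pos-and-neg-parts≈0 cs combo≈0 x)) ab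

    brackets-span : ∀ n k (v : M n k) → ∃ λ (cs : DisjointPair n k → Carrier) → combo cs ≈V v
    brackets-span zero    zero    v = (λ _ → v []) , λ { [] → *-identityʳ _ }
    brackets-span zero    (suc k) v = (λ ()) , λ ()
    brackets-span (suc n) zero    v with brackets-span n zero (λ x → v (skip x))
    ... | cs , combo≈v = (λ { (skip ab) → cs ab }) , λ { (skip x) → combo≈v x }
    brackets-span (suc n) (suc k) v
      with brackets-span n (suc k) (λ x → v (skip x))
         | brackets-span n k (λ x → ½ * (v (pos x) + v (neg x)))
         | brackets-span n k (λ x → ½ * (v (pos x) - v (neg x)))
    ... | cs , S≈ | cp , P≈ | cn , N≈ = glue , combo≈v
      where
      glue : DisjointPair (suc n) (suc k) → Carrier
      glue (skip ab) = cs ab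
      glue (pos ab)  = cp ab
      glue (neg ab)  = cn ab

      combo≈v : combo glue ≈V v
      combo≈v (skip x) = trans (combo-skip glue x) (S≈ x)
      combo≈v (pos x)  = trans (combo-pos glue x)
        (trans (+-cong (P≈ x) (N≈ x)) (½[x+y]+½[x-y]≈x _ _))
      combo≈v (neg x)  = trans (combo-neg glue x)
        (trans (+-cong (P≈ x) (-‿cong (N≈ x))) (½[x+y]-½[x-y]≈y _ _))

module _ {c ℓ : Level} (F : CommutativeRing c ℓ) where
  open CommutativeRing F
  open import Relation.Binary.Reasoning.Setoid setoid

  field-charNot2⇒½ : IsField F → CharNot2 F → Σ Carrier λ ½ → ½ + ½ ≈ 1#
  field-charNot2⇒½ isField 2≉0 with IsField.inverse isField (1# + 1#) 2≉0
  ... | ½ , 2*½≈1 = ½ , (begin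
    ½ + ½               ≈⟨ +-cong (*-identityˡ ½) (*-identityˡ ½) ⟨
    1# * ½ + 1# * ½     ≈⟨ distribʳ ½ 1# 1# ⟨
    (1# + 1#) * ½       ≈⟨ 2*½≈1 ⟩
    1#                  ∎)

-- For k > n both Face n k and DisjointPair n k are empty.
proposition2p1 : {c ℓ : Level} (F : CommutativeRing c ℓ) → IsField F → CharNot2 F →
    (n k : ℕ) → k ≤ n → Space.IsBasisOfBrackets F n k
proposition2p1 F isField 2≉0 n k _ with field-charNot2⇒½ F isField 2≉0
... | ½ , ½+½≈1 = brackets-independent ½ ½+½≈1 n k , brackets-span ½ ½+½≈1 n k
  where open BracketBasis F
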